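{- Let $G_n$ and $T$ be as in the context, and let $k\ge n+2$. Let $W=v_0e_0v_1e_1\cdots e_{k-1}v_k$ be a walk all of whose arcs belong to $T$. Then $l(e_0)\le l(e_{n+1})$.
   Context: Let $A$ be a finite alphabet with a linear order $<$, extended to words by the lexicographic order. Let $\mathcal{F}$ be a set of words over $A$ (forbidden factors). A word $w$ is in the language if the bi-infinite periodic word $\cdots www\cdots$ contains no word of $\mathcal{F}$ as a factor; $W_k$ denotes the set of words of length $k$ in the language. Fix $n\ge1$. Consider the digraph with vertex set $A^n$ having an arc from $as$ to $sb$ ($a,b\in A$, $s\in A^{n-1}$) whenever $asb\in W_{n+1}$; this arc has label $l=b$. The de Bruijn graph $G_n$ is a strongly connected component of this digraph with the maximum number of vertices (unique when the subshift is irreducible). Vertices are identified with their words. Let $m$ be the lexicographically maximal vertex of $G_n$. For each vertex $v$ let $e(v)$ be the arc of $G_n$ with tail $v$ of maximum label, and $\gamma(v)$ its label. $T$ is the spanning subgraph of $G_n$ with arc set $\{e(v): v\neq m\}$. -}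

module Defs where

open import Level using (Level; suc; _⊔_)
open import Data.Nat as ℕ using (ℕ)
open import Data.Fin as Fin using (Fin)
open import Data.List as List using (List; []; _∷_; _++_; concat; replicate; length)
open import Data.List.Relation.Unary.Unique.Propositional using (Unique)
open import Data.List.Membership.Propositional using (_∈_)
open import Data.Vec as Vec using (Vec; []; _∷_; _∷ʳ_; toList)
open import Data.Product using (Σ; ∃; ∃-syntax; _×_; _,_)
open import Data.Sum using (_⊎_)
open import Data.Unit using (⊤)
open import Data.Empty using (⊥)
open import Relation.Nullary using (¬_)
open import Relation.Binary.PropositionalEquality using (_≡_)
open import Relation.Binary.Construct.Closure.ReflexiveTransitive using (Star)
open import Function.Bundles using (_⇔_)

-- Alphabet: Fin q with its natural linear order.
-- Forbidden set F: an arbitrary predicate on words (List (Fin q)).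

Word : ℕ → Set
Word q = List (Fin q)

-- u is a factor of the bi-infinite periodic word ...www...
-- (equivalently: u is a factor of some finite power w^t)
PeriodicFactor : ∀ {q} → Word q → Word q → Set
PeriodicFactor u w = ∃[ t ] ∃[ p ] ∃[ s ] (p ++ u ++ s ≡ concat (replicate t w))

InLang : ∀ {q} (F : Word q → Set) → Word q → Set
InLang F w = ∀ u → F u → ¬ PeriodicFactor u w

Vertex : ℕ → ℕ → Set
Vertex q n = Vec (Fin q) n

shift : ∀ {q n} → Vertex q (ℕ.suc n) → Fin q → Vertex q (ℕ.suc n)
shift (a ∷ s) b = s ∷ʳ b

Arc : ∀ {q n} (F : Word q → Set) → Vertex q (ℕ.suc n) → Fin q → Vertex q (ℕ.suc n) → Set
Arc F u b w = (w ≡ shift u b) × InLang F (toList u ++ (b ∷ []))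

Adj : ∀ {q n} (F : Word q → Set) → Vertex q (ℕ.suc n) → Vertex q (ℕ.suc n) → Set
Adj F u w = ∃[ b ] Arc F u b w

Reach : ∀ {q n} (F : Word q → Set) → Vertex q (ℕ.suc n) → Vertex q (ℕ.suc n) → Set
Reach F = Star (Adj F)

Comp : ∀ {q n} (F : Word q → Set) → Vertex q (ℕ.suc n) → Vertex q (ℕ.suc n) → Set
Comp F r v = Reach F r v × Reach F v r

HasSize : ∀ {A : Set} → (A → Set) → ℕ → Set
HasSize {A} P N = ∃[ xs ] (Unique xs × length xs ≡ N × (∀ (v : A) → P v ⇔ (v ∈ xs)))

-- The SCC of r has the maximum number of vertices among all SCCs
-- (i.e. it is a de Bruijn graph G_n).
IsMaxComp : ∀ {q n} (F : Word q → Set) → Vertex q (ℕ.suc n) → Set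
IsMaxComp {q} {n} F r =
  ∃[ N ] (HasSize (Comp F r) N × (∀ (r' : Vertex q (ℕ.suc n)) N' → HasSize (Comp F r') N' → N' ℕ.≤ N))

GArc : ∀ {q n} (F : Word q → Set) (r : Vertex q (ℕ.suc n)) →
       Vertex q (ℕ.suc n) → Fin q → Vertex q (ℕ.suc n) → Set
GArc F r u b w = Arc F u b w × Comp F r u × Comp F r w

_≤lex_ : ∀ {q n} → Vertex q n → Vertex q n → Set
[] ≤lex [] = ⊤
(a ∷ u) ≤lex (b ∷ v) = (a Fin.< b) ⊎ ((a ≡ b) × (u ≤lex v))

IsLexMax : ∀ {q n} (F : Word q → Set) (r m : Vertex q (ℕ.suc n)) → Set
IsLexMax F r m = Comp F r m × (∀ v → Comp F r v → v ≤lex m)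

TArc : ∀ {q n} (F : Word q → Set) (r m : Vertex q (ℕ.suc n)) →
       Vertex q (ℕ.suc n) → Fin q → Vertex q (ℕ.suc n) → Set
TArc F r m u b w =
  GArc F r u b w × ¬ (u ≡ m) × (∀ b' w' → GArc F r u b' w' → b' Fin.≤ b)

module Submission where

-- Let the T-walk be v₀ →l₀ v₁ →l₁ ⋯ (vertices of length n+1).
-- Every arc shifts in its label, so v_{n+1} = l₀⋯lₙ and v_{n+2} = l₁⋯l_{n+1}.
-- The arc at v_{n+1} shows that the word c = l₀⋯l_{n+1} lies in the language;
-- since the language is defined by factors of the bi-infinite word ⋯ccc⋯ it is
-- closed under rotation, so all rotations of c lie in it.  Hence the length-(n+1)
-- windows of the periodic stream ccc⋯ form a closed walk of arcs
--     W₀ → W₁ → ⋯ → W_{n+1} → W_{n+2} = W₀,   with W₀ = v_{n+1}, W₁ = v_{n+2}.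
-- The cycle arc W₁ → W₂ has label l₀, and W₂ lies in the component G_n because
-- it is reached from v_{n+2} and reaches W₁ = v_{n+2} around the cycle.  The T-arc
-- at v_{n+2} has the maximal label among G_n-arcs out of v_{n+2}, so l₀ ≤ l_{n+2}.

open import Defs
open import Data.Nat using (ℕ; zero; suc; _+_; _≤_; _<_; _%_; z≤n; s≤s)
open import Data.Nat.Properties using (+-assoc; +-comm; +-suc; ≤-refl; ≤-trans; +-mono-≤; <⇒≤)
open import Data.Nat.DivMod using (m<n⇒m%n≡m; [m+n]%n≡m%n)
open import Data.Fin as Fin using (Fin)
open import Data.List using (List; []; _∷_; _++_; concat; replicate)
open import Data.List.Properties using (++-assoc; ++-identityʳ)
open import Data.Vec using (Vec; []; _∷_; _∷ʳ_; toList)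
open import Data.Vec.Properties using (toList-∷ʳ)
open import Data.Product using (_,_; proj₁; proj₂)
open import Relation.Binary.PropositionalEquality
  using (_≡_; refl; sym; trans; cong; cong₂; subst; subst₂; module ≡-Reasoning)
open import Relation.Binary.Construct.Closure.ReflexiveTransitive using (ε; _◅_; _◅◅_)

-- Streams are functions ℕ → A.  drop j f forgets the first j entries of f; it is
-- defined so that drop (suc j) f is definitionally drop j f shifted by one place.
drop : ∀ {A : Set} → ℕ → (ℕ → A) → ℕ → A
drop zero    f t = f t
drop (suc j) f t = drop j f (suc t)

drop-index : ∀ {A : Set} j (f : ℕ → A) t → drop j f t ≡ f (j + t)
drop-index zero    f t = refl
drop-index (suc j) f t = trans (drop-index j f (suc t)) (cong f (+-suc j t))

prefix : ∀ {A : Set} → (ℕ → A) → (L : ℕ) → Vec A L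
prefix f zero    = []
prefix f (suc L) = f 0 ∷ prefix (drop 1 f) L

prefix-cong : ∀ {A : Set} {f g : ℕ → A} L → (∀ t → t < L → f t ≡ g t) → prefix f L ≡ prefix g L
prefix-cong zero    eq = refl
prefix-cong (suc L) eq = cong₂ _∷_ (eq 0 (s≤s z≤n)) (prefix-cong L (λ t t<L → eq (suc t) (s≤s t<L)))

prefix-∷ʳ : ∀ {A : Set} (f : ℕ → A) L → prefix f (suc L) ≡ prefix f L ∷ʳ f L
prefix-∷ʳ f zero    = refl
prefix-∷ʳ f (suc L) = cong (f 0 ∷_) (prefix-∷ʳ (drop 1 f) L)

toList-prefix-∷ʳ : ∀ {A : Set} (f : ℕ → A) L →
                   toList (prefix f L) ++ f L ∷ [] ≡ toList (prefix f (suc L))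
toList-prefix-∷ʳ f L = sym (trans (cong toList (prefix-∷ʳ f L)) (toList-∷ʳ (f L) (prefix f L)))

_++ˢ_ : ∀ {A : Set} {L} → Vec A L → (ℕ → A) → ℕ → A
([]      ++ˢ f) t       = f t
((x ∷ u) ++ˢ f) zero    = x
((x ∷ u) ++ˢ f) (suc t) = (u ++ˢ f) t

prefix-++ˢ : ∀ {A : Set} {L} (u : Vec A L) (f : ℕ → A) → prefix (u ++ˢ f) L ≡ u
prefix-++ˢ []      f = refl
prefix-++ˢ (x ∷ u) f = cong (x ∷_) (prefix-++ˢ u f)

++ˢ-index : ∀ {A : Set} {L} (u : Vec A L) (f : ℕ → A) t → (u ++ˢ f) (L + t) ≡ f t
++ˢ-index []      f t = refl
++ˢ-index (x ∷ u) f t = ++ˢ-index u f t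

Periodic : ∀ {A : Set} → ℕ → (ℕ → A) → Set
Periodic P f = ∀ t → f (t + P) ≡ f t

drop-periodic : ∀ {A : Set} {P} {f : ℕ → A} → Periodic P f → ∀ j → Periodic P (drop j f)
drop-periodic per zero    = per
drop-periodic per (suc j) t = drop-periodic per j (suc t)

drop-period : ∀ {A : Set} {P} {f : ℕ → A} → Periodic P f → ∀ j t → drop (P + j) f t ≡ drop j f t
drop-period {P = P} {f} per j t = begin
  drop (P + j) f t   ≡⟨ drop-index (P + j) f t ⟩
  f (P + j + t)      ≡⟨ cong f (trans (+-assoc P j t) (+-comm P (j + t))) ⟩
  f (j + t + P)      ≡⟨ per (j + t) ⟩
  f (j + t)          ≡⟨ sym (drop-index j f t) ⟩
  drop j f t         ∎
  where open ≡-Reasoning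

periodize : ∀ {A : Set} → ℕ → (ℕ → A) → ℕ → A
periodize p f t = f (t % suc p)

periodize-periodic : ∀ {A : Set} p (f : ℕ → A) → Periodic (suc p) (periodize p f)
periodize-periodic p f t = cong f ([m+n]%n≡m%n t (suc p))

periodize-agrees : ∀ {A : Set} p (f : ℕ → A) {t} → t < suc p → periodize p f t ≡ f t
periodize-agrees p f t<P = cong f (m<n⇒m%n≡m t<P)

shift-prefix : ∀ {q n} (f : ℕ → Fin q) → shift (prefix f (suc n)) (f (suc n)) ≡ prefix (drop 1 f) (suc n)
shift-prefix {n = n} f = sym (prefix-∷ʳ (drop 1 f) n)

walk-window : ∀ {q n K} (v : ℕ → Vertex q (suc n)) (l : ℕ → Fin q) →
              (∀ i → i < K → v (suc i) ≡ shift (v i) (l i)) →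
              ∀ i → i ≤ K → v i ≡ prefix (drop i (v 0 ++ˢ l)) (suc n)
walk-window v l step zero    _   = sym (prefix-++ˢ (v 0) l)
walk-window {n = n} v l step (suc i) i<K = begin
  v (suc i)                         ≡⟨ step i i<K ⟩
  shift (v i) (l i)                 ≡⟨ cong₂ shift (walk-window v l step i (<⇒≤ i<K)) label ⟩
  shift (prefix hᵢ (suc n)) (hᵢ (suc n)) ≡⟨ shift-prefix hᵢ ⟩
  prefix (drop (suc i) h) (suc n)   ∎
  where
  open ≡-Reasoning
  h hᵢ : ℕ → Fin _
  h  = v 0 ++ˢ l
  hᵢ = drop i h
  label : l i ≡ hᵢ (suc n)
  label = sym (trans (drop-index i h (suc n))
                     (trans (cong h (+-comm i (suc n))) (++ˢ-index (v 0) l i)))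

-- The language is closed under rotation: ⋯(aw)(aw)⋯ and ⋯(wa)(wa)⋯ are the same
-- bi-infinite word.  Finitely: a factor of (wa)^t is a factor of (aw)^(t+1).
concat-replicate-rotate : ∀ {A : Set} (a : A) (w : List A) t →
  concat (replicate (suc t) (a ∷ w)) ≡ a ∷ (concat (replicate t (w ++ a ∷ [])) ++ w)
concat-replicate-rotate a w zero    = cong (a ∷_) (++-identityʳ w)
concat-replicate-rotate a w (suc t) = cong (a ∷_) (begin
  w ++ concat (replicate (suc t) (a ∷ w))
    ≡⟨ cong (w ++_) (concat-replicate-rotate a w t) ⟩
  w ++ a ∷ (concat (replicate t (w ++ a ∷ [])) ++ w)
    ≡⟨ sym (++-assoc w (a ∷ []) _) ⟩
  (w ++ a ∷ []) ++ (concat (replicate t (w ++ a ∷ [])) ++ w)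
    ≡⟨ sym (++-assoc (w ++ a ∷ []) _ w) ⟩
  ((w ++ a ∷ []) ++ concat (replicate t (w ++ a ∷ []))) ++ w ∎)
  where open ≡-Reasoning

inLang-rotate : ∀ {q} (F : Word q → Set) a w → InLang F (a ∷ w) → InLang F (w ++ a ∷ [])
inLang-rotate F a w inL u u∈F (t , p , s , p++u++s≡) = inL u u∈F (suc t , a ∷ p , s ++ w , factor)
  where
  open ≡-Reasoning
  factor : (a ∷ p) ++ u ++ s ++ w ≡ concat (replicate (suc t) (a ∷ w))
  factor = begin
    a ∷ (p ++ u ++ s ++ w)    ≡⟨ cong (λ z → a ∷ (p ++ z)) (sym (++-assoc u s w)) ⟩
    a ∷ (p ++ (u ++ s) ++ w)  ≡⟨ cong (a ∷_) (sym (++-assoc p (u ++ s) w)) ⟩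
    a ∷ ((p ++ u ++ s) ++ w)  ≡⟨ cong (λ z → a ∷ (z ++ w)) p++u++s≡ ⟩
    a ∷ (concat (replicate t (w ++ a ∷ [])) ++ w) ≡⟨ sym (concat-replicate-rotate a w t) ⟩
    concat (replicate (suc t) (a ∷ w)) ∎

-- For a stream of period L+1, the period word read from position 1 is a
-- rotation of the one read from position 0, so it stays in the language.
inLang-prefix-rotate : ∀ {q} {F : Word q → Set} {f : ℕ → Fin q} {L} → Periodic (suc L) f →
                       InLang F (toList (prefix f (suc L))) → InLang F (toList (prefix (drop 1 f) (suc L)))
inLang-prefix-rotate {F = F} {f} {L} per inL =
  subst (InLang F) rotated (inLang-rotate F (f 0) (toList (prefix (drop 1 f) L)) inL)
  where
  rotated : toList (prefix (drop 1 f) L) ++ f 0 ∷ [] ≡ toList (prefix (drop 1 f) (suc L))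
  rotated = trans (cong (λ b → toList (prefix (drop 1 f) L) ++ b ∷ []) (sym (per 0)))
                  (toList-prefix-∷ʳ (drop 1 f) L)

prefix-arc : ∀ {q n} (F : Word q → Set) (f : ℕ → Fin q) → InLang F (toList (prefix f (suc (suc n)))) →
             Arc F (prefix f (suc n)) (f (suc n)) (prefix (drop 1 f) (suc n))
prefix-arc {n = n} F f inL = sym (shift-prefix f) , subst (InLang F) (sym (toList-prefix-∷ʳ f (suc n))) inL

module Cycle {q n} (F : Word q → Set) (c : ℕ → Fin q) (per : Periodic (suc (suc n)) c)
             (word : InLang F (toList (prefix c (suc (suc n))))) where

  window : ℕ → Vertex q (suc n)
  window j = prefix (drop j c) (suc n)

  window-inLang : ∀ j → InLang F (toList (prefix (drop j c) (suc (suc n))))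
  window-inLang zero    = word
  window-inLang (suc j) = inLang-prefix-rotate (drop-periodic per j) (window-inLang j)

  window-arc : ∀ j → Arc F (window j) (drop j c (suc n)) (window (suc j))
  window-arc j = prefix-arc F (drop j c) (window-inLang j)

  window-reach : ∀ j d → Reach F (window j) (window (d + j))
  window-reach j zero    = ε
  window-reach j (suc d) = window-reach j d ◅◅ ((drop (d + j) c (suc n) , window-arc (d + j)) ◅ ε)

  -- Going once around the cycle, every window reaches its predecessor.
  window-reach-pred : ∀ j → Reach F (window (suc j)) (window j)
  window-reach-pred j = subst (Reach F (window (suc j))) around (window-reach (suc j) (suc n))
    where
    around : window (suc n + suc j) ≡ window j
    around = trans (cong window (+-suc (suc n) j)) (prefix-cong (suc n) (λ t _ → drop-period per j t))

module TWalk (q n : ℕ) (F : Word q → Set) (r m : Vertex q (suc n)) (K : ℕ) (n+3≤K : n + 3 ≤ K)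
             (v : ℕ → Vertex q (suc n)) (l : ℕ → Fin q)
             (T : ∀ i → i < K → TArc F r m (v i) (l i) (v (suc i))) where

  step : ∀ i → i < K → v (suc i) ≡ shift (v i) (l i)
  step i i<K = proj₁ (proj₁ (proj₁ (T i i<K)))

  n+2<K : suc (suc n) < K
  n+2<K = subst (_≤ K) (+-comm n 3) n+3≤K

  -- The cyclic word c = l₀ ⋯ l_{n+1}, repeated forever.
  c : ℕ → Fin q
  c = periodize (suc n) l

  walk-on-cycle : ∀ j → j ≤ 1 → v (j + suc n) ≡ prefix (drop j c) (suc n)
  walk-on-cycle j j≤1 = trans (walk-window v l step (j + suc n) j+n+1≤K)
                              (prefix-cong (suc n) entries)
    where
    open ≡-Reasoning
    h : ℕ → Fin q
    h = v 0 ++ˢ l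
    j+n+1≤K : j + suc n ≤ K
    j+n+1≤K = ≤-trans (+-mono-≤ j≤1 ≤-refl) (<⇒≤ n+2<K)
    entries : ∀ t → t < suc n → drop (j + suc n) h t ≡ drop j c t
    entries t t<n+1 = begin
      drop (j + suc n) h t   ≡⟨ drop-index (j + suc n) h t ⟩
      h (j + suc n + t)      ≡⟨ cong h (trans (cong (_+ t) (+-comm j (suc n))) (+-assoc (suc n) j t)) ⟩
      h (suc n + (j + t))    ≡⟨ ++ˢ-index (v 0) l (j + t) ⟩
      l (j + t)              ≡⟨ sym (periodize-agrees (suc n) l (s≤s (≤-trans (+-mono-≤ j≤1 ≤-refl) t<n+1))) ⟩
      c (j + t)              ≡⟨ sym (drop-index j c t) ⟩
      drop j c t             ∎

  -- The arc of the walk at v_{n+1} puts the cyclic word into the language.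
  cycle-word : InLang F (toList (prefix c (suc (suc n))))
  cycle-word = subst (InLang F) word-is-c (proj₂ (proj₁ (proj₁ (T (suc n) (<⇒≤ n+2<K)))))
    where
    word-is-c : toList (v (suc n)) ++ l (suc n) ∷ [] ≡ toList (prefix c (suc (suc n)))
    word-is-c = trans (cong₂ (λ u b → toList u ++ b ∷ []) (walk-on-cycle 0 z≤n)
                                (sym (periodize-agrees (suc n) l ≤-refl)))
                      (toList-prefix-∷ʳ c (suc n))

  open Cycle F c (periodize-periodic (suc n) l) cycle-word

  -- The cycle arc out of v_{n+2} has label l₀ and stays in G_n, so the
  -- maximal label l_{n+2} at v_{n+2} bounds it.
  l₀≤lₙ₊₂ : l 0 Fin.≤ l (suc (suc n))
  l₀≤lₙ₊₂ = maximal (l 0) (window 2) (arc , comp-v , comp-window₂)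
    where
    tarc : TArc F r m (v (suc (suc n))) (l (suc (suc n))) (v (suc (suc (suc n))))
    tarc = T (suc (suc n)) n+2<K
    comp-v : Comp F r (v (suc (suc n)))
    comp-v = proj₁ (proj₂ (proj₁ tarc))
    maximal : ∀ b w → GArc F r (v (suc (suc n))) b w → b Fin.≤ l (suc (suc n))
    maximal = proj₂ (proj₂ tarc)
    v≡window₁ : v (suc (suc n)) ≡ window 1
    v≡window₁ = walk-on-cycle 1 (s≤s z≤n)
    label : drop 1 c (suc n) ≡ l 0
    label = trans (periodize-periodic (suc n) l 0) (periodize-agrees (suc n) l (s≤s z≤n))
    arc : Arc F (v (suc (suc n))) (l 0) (window 2)
    arc = subst₂ (λ u b → Arc F u b (window 2)) (sym v≡window₁) label (window-arc 1)
    comp-window₂ : Comp F r (window 2)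
    comp-window₂ = proj₁ comp-v ◅◅ ((l 0 , arc) ◅ ε)
                 , window-reach-pred 1 ◅◅ subst (λ u → Reach F u r) v≡window₁ (proj₂ comp-v)

lemma2 : ∀ (q n : ℕ) (F : Word q → Set) (r m : Vertex q (suc n)) →
         IsMaxComp F r → IsLexMax F r m →
         ∀ (k : ℕ) → n + 3 ≤ k →
         (v : ℕ → Vertex q (suc n)) (l : ℕ → Fin q) →
         (∀ i → i < k → TArc F r m (v i) (l i) (v (suc i))) →
         l 0 Fin.≤ l (n + 2)
lemma2 q n F r m _ _ k n+3≤k v l T =
  subst (λ i → l 0 Fin.≤ l i) (+-comm 2 n) (TWalk.l₀≤lₙ₊₂ q n F r m k n+3≤k v l T)
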